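{- With $\mathcal{A}$, $T$ and Algorithm B as in the context, for any strings $u,v$ and integer $m\ge2$, Algorithm B on input $(u,v)$ with parameter $m$ runs in time $\tilde{O}(T(|u|+|v|)\cdot m^5)$.
   Context: The edit distance $\Delta_{\text{ed}}(x,y)$ is the minimum number of single-character insertions, deletions and substitutions transforming $x$ into $y$. $u[i:j]=u_i\cdots u_j$. A partition of $u$ into $m$ parts is $(p_0,\dots,p_m)$ with $0=p_0\le\cdots\le p_m=|u|$, $i$-th part $u[p_{i-1}+1:p_i]$; an equipartition has all parts of size $\lfloor|u|/m\rfloor$ or $\lceil|u|/m\rceil$. The black box $\mathcal{A}$ satisfies: there is a non-decreasing $\gamma$ with $\Delta_{\text{ed}}(u,v)\le\mathcal{A}(u,v)\le\gamma(n)\Delta_{\text{ed}}(u,v)$ whenever $|u|+|v|\le n$; and $\mathcal{A}(u,v)$ with $|u|+|v|\le n$ runs in time at most $T(n)$ for a non-decreasing $T$ with $T(j)+T(k)\le T(j+k)$ for $j,k\ge0$. Algorithm B with parameter $m\ge2$ on input $u,v$: (1) if $|u|\le1$, find an optimal alignment naively in time $O(|v|)$; (2) let $P=(p_0,\dots,p_m)$ be an equipartition of $u$ with parts $P_i$; (3) let $S=(\{p_0,\dots,p_m\}\cup\{|v|\}\cup\{\lceil p_i\pm(1+\frac1m)^j\rceil: i,j\ge0\})\cap\{0,\dots,|v|\}$; (4) by dynamic programming with subproblems $f(l,j)$ ($l\in S$, $0\le j\le m$: the best choice of $q_0,\dots,q_j$ with $q_j=l$), each computed from all $f(l',j-1)$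 with $l'\le l$, $l'\in S$, by adding $\mathcal{A}(P_j,v[l'+1:l])$, find a partition $Q$ of $v$ with all $q_i\in S$ minimizing $\sum_i\mathcal{A}(P_i,Q_i)$; (5) recurse on each pair $(P_i,Q_i)$ and combine the alignments. $\tilde O$ hides polylogarithmic factors. -}

module Defs where

open import Data.Bool using (if_then_else_)
open import Data.Nat using (ℕ; zero; suc; _+_; _*_; _∸_; _^_; _≤_; _<_; _⊓_; _/_; _≤?_; _<?_)
import Data.Nat.Properties as ℕP
open import Data.List using (List; []; _∷_; length; take; drop; filter; deduplicate; map; concatMap; upTo; _++_)
open import Data.Nat.ListAction using (sum)
open import Data.List.Membership.Propositional using (_∈_)
open import Relation.Binary.Definitions using (DecidableEquality)
open import Relation.Binary.PropositionalEquality using (_≡_)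
open import Relation.Nullary using (does; yes; no)

module _ {X : Set} (_≟_ : DecidableEquality X) where
  ed : List X → List X → ℕ
  ed [] ys = length ys
  ed (x ∷ xs) [] = suc (length xs)
  ed (x ∷ xs) (y ∷ ys) =
    (ed xs ys + (if does (x ≟ y) then 0 else 1)) ⊓ suc (ed xs (y ∷ ys) ⊓ ed (x ∷ xs) ys)

-- floor division, with the (unused) convention a / 0 = 0
divℕ : ℕ → ℕ → ℕ
divℕ a zero = 0
divℕ a (suc k) = a / suc k

-- u[a+1 : b] = u_{a+1} ... u_b
slice : {X : Set} → List X → ℕ → ℕ → List X
slice u a b = take (b ∸ a) (drop a u)

-- ⌊(1 + 1/m)^j⌋ and ⌈(1 + 1/m)^j⌉  (as (m+1)^j / m^j)
rfloor : ℕ → ℕ → ℕ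
rfloor m j = divℕ (suc m ^ j) (m ^ j)

rceil : ℕ → ℕ → ℕ
rceil m j = divℕ (suc m ^ j + m ^ j ∸ 1) (m ^ j)

firstExceed : ℕ → ℕ → ℕ → ℕ → ℕ
firstExceed m n j zero = j
firstExceed m n j (suc f) with n <? rfloor m j
... | yes _ = j
... | no _ = firstExceed m n (suc j) f

-- For j > Jbound m n we have (1+1/m)^j > n + 1 (Bernoulli), so no
-- further j can produce an element of S (which is ⊆ {0..|v|}, n ≥ |u|,|v|).
Jbound : ℕ → ℕ → ℕ
Jbound m n = firstExceed m n 0 (m * suc n + 1)

-- Partitions (indices q 0, ..., q m; values beyond m are irrelevant)

record IsPartition (m len : ℕ) (q : ℕ → ℕ) : Set where
  field
    first : q 0 ≡ 0
    last  : q m ≡ len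
    mono  : ∀ i → i < m → q i ≤ q (suc i)

-- i-th part (0-based i ; this is the paper's (i+1)-th part)
part : {X : Set} → (ℕ → ℕ) → List X → ℕ → List X
part q w i = slice w (q i) (q (suc i))

record BlackBox (X : Set) : Set where
  field
    𝒜    : List X → List X → ℕ
    time : List X → List X → ℕ

open BlackBox public

module AlgorithmB {X : Set} (bb : BlackBox X) (m : ℕ) where

  eqp : List X → ℕ → ℕ
  eqp u i = divℕ (i * length u) m

  P : List X → ℕ → List X
  P u i = part (eqp u) u i

  -- raw candidate list for S: p_i, |v|, ⌈p_i + r⌉ = p_i + ⌈r⌉, and
  -- ⌈p_i - r⌉ = p_i - ⌊r⌋ (only when ≥ 0), r = (1+1/m)^j, 0 ≤ j ≤ J,
  -- restricted to {0, ..., |v|}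
  J : List X → List X → ℕ
  J u v = Jbound m (length u + length v)

  rawS : List X → List X → List ℕ
  rawS u v = filter (_≤? length v)
    (length v ∷ concatMap (λ i → eqp u i ∷ concatMap (λ j →
        (eqp u i + rceil m j) ∷
        (if does (rfloor m j ≤? eqp u i) then (eqp u i ∸ rfloor m j) ∷ [] else []))
      (upTo (suc (J u v))))
      (upTo (suc m)))

  S : List X → List X → List ℕ
  S u v = deduplicate ℕP._≟_ (rawS u v)

  objective : List X → List X → (ℕ → ℕ) → ℕ
  objective u v q = sum (map (λ i → 𝒜 bb (P u i) (part q v i)) (upTo m))

  -- cost of the dynamic program: for each part j and each pair l' ≤ l in S,
  -- one call 𝒜(P_j, v[l'+1:l]) (its running time) plus one unit of work
  dpCost : List X → List X → ℕ
  dpCost u v = sum (map (λ j → sum (map (λ l →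
      sum (map (λ l' → suc (time bb (P u j) (slice v l' l)))
               (filter (_≤? l) (S u v))))
      (S u v))) (upTo m))

  -- non-recursive work of one call of B with |u| ≥ 2:
  -- equipartition, generating S (loop iterations and quadratic deduplication),
  -- the DP, backtracking the optimal partition, splitting and combining
  overhead : List X → List X → ℕ
  overhead u v =
      suc m
    + suc m * suc (J u v)
    + length (rawS u v) * length (rawS u v)
    + dpCost u v
    + suc m * length (S u v)
    + suc (length u + length v)

  -- Run u v t : some execution of Algorithm B on (u, v) takes time t.
  -- (nondeterministic only in the choice among optimal partitions Q)
  data Run : List X → List X → ℕ → Set where
    base : ∀ {u v} → length u ≤ 1 → Run u v (suc (length v))
    step : ∀ {u v} → 2 ≤ length u →
           (q : ℕ → ℕ) → IsPartition m (length v) q →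
           (∀ i → i ≤ m → q i ∈ S u v) →
           (∀ q′ → IsPartition m (length v) q′ → (∀ i → i ≤ m → q′ i ∈ S u v) →
              objective u v q ≤ objective u v q′) →
           (ts : ℕ → ℕ) →
           (∀ i → i < m → Run (P u i) (part q v i) (ts i)) →
           Run u v (overhead u v + sum (map ts (upTo m)))

module Submission where

-- The proof follows the structure of the algorithm.
--   * Every part of the equipartition has at most half (rounded up) of the
--     characters of u, so a call on u with |u| ≤ 2^d recurses to depth ≤ d.
--   * The exponent range of the candidate set S is bounded via Bernoulli's
--     inequality, (1 + 1/m)^(m·a) ≥ 2^a, so |S| = O(m² log n); hence one call
--     does O(m · |S|²) black-box calls of cost ≤ T(n) and its total
--     non-recursive work is O(m⁵ log² n · T(n)).
--   * The recursive calls of one node act on disjoint pieces of u and v; by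
--     superadditivity of T their budgets T(nᵢ) add up to at most T(n).  An
--     induction on the depth then bounds the total time by
--     (depth + 1) · O(m⁵ log² n) · T(n) + 1.
--   * Runs exist: an optimal partition is found by minimising the objective
--     over an explicit enumeration of all breakpoint vectors with values in S.

open import Defs
open import Function using (_∘_)
open import Data.Nat
import Data.Nat as ℕ
open import Data.Nat.Properties
open import Data.Nat.DivMod using (m/n*n≤m; m*n/n≡m; /-monoˡ-≤; m≡m%n+[m/n]*n; m%n<n)
open import Data.Nat.Logarithm using (⌊log₂_⌋; ⌊log₂⌋-mono-≤; ⌊log₂[2^n]⌋≡n)
open import Data.Nat.Logarithm.Core using (⌊log2⌋)
open import Data.Nat.Induction using (<-wellFounded)
open import Induction.WellFounded using (Acc; acc)
open import Data.Nat.ListAction using (sum)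
open import Data.Nat.Tactic.RingSolver using (solve-∀)
open import Data.Bool using (true; false; if_then_else_)
open import Data.List using (List; []; _∷_; length; map; upTo; applyUpTo; concatMap; filter; drop; take)
open import Data.List.Properties using (length-upTo; length-filter; length-deduplicate; length-++; length-take; length-drop; map-upTo)
open import Data.List.Membership.Propositional using (_∈_)
open import Data.List.Relation.Unary.Any using (here; there)
import Data.List.Relation.Unary.Any as Any
import Data.List.Relation.Unary.All as All
open import Data.List.Relation.Unary.All.Properties using (all-filter)
open import Data.List.Membership.Propositional.Properties using (∈-filter⁺; ∈-deduplicate⁺; ∈-concatMap⁺; ∈-map⁺; ∈-upTo⁻)
open import Data.List.Membership.DecPropositional _≟_ using (_∈?_)
open import Data.List.Extrema.Nat using (argmin; f[argmin]≤f[xs]; argmin-all)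
open import Data.Empty using (⊥-elim)
open import Data.Product using (Σ; _×_; _,_; proj₁; proj₂)
open import Data.Sum using (inj₁; inj₂)
open import Relation.Binary.PropositionalEquality using (_≡_; refl; sym; trans; cong; cong₂; subst; subst₂; module ≡-Reasoning)
open import Relation.Binary.Definitions using (DecidableEquality)
open import Relation.Nullary using (Dec; yes; no; does)
open import Relation.Nullary.Decidable using (map′; _×-dec_)

module _ {A : Set} where

  sum-map-mono : (xs : List A) (f g : A → ℕ) → (∀ x → x ∈ xs → f x ≤ g x) →
    sum (map f xs) ≤ sum (map g xs)
  sum-map-mono []       f g f≤g = z≤n
  sum-map-mono (x ∷ xs) f g f≤g =
    +-mono-≤ (f≤g x (here refl)) (sum-map-mono xs f g (λ y y∈ → f≤g y (there y∈)))

  sum-map-≤-const : (xs : List A) (f : A → ℕ) (c : ℕ) → (∀ x → x ∈ xs → f x ≤ c) →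
    sum (map f xs) ≤ length xs * c
  sum-map-≤-const []       f c f≤c = z≤n
  sum-map-≤-const (x ∷ xs) f c f≤c =
    +-mono-≤ (f≤c x (here refl)) (sum-map-≤-const xs f c (λ y y∈ → f≤c y (there y∈)))

  sum-map-+ : (xs : List A) (f g : A → ℕ) →
    sum (map (λ x → f x + g x) xs) ≡ sum (map f xs) + sum (map g xs)
  sum-map-+ []       f g = refl
  sum-map-+ (x ∷ xs) f g rewrite sum-map-+ xs f g = shuffle (f x) (g x) (sum (map f xs)) (sum (map g xs))
    where
    shuffle : ∀ a b c d → a + b + (c + d) ≡ a + c + (b + d)
    shuffle = solve-∀

  sum-map-affine : (xs : List A) (f : A → ℕ) (a : ℕ) →
    sum (map (λ x → a * f x + 1) xs) ≡ a * sum (map f xs) + length xs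
  sum-map-affine []       f a = sym (trans (+-identityʳ _) (*-zeroʳ a))
  sum-map-affine (x ∷ xs) f a rewrite sum-map-affine xs f a = regroup a (f x) (sum (map f xs)) (length xs)
    where
    regroup : ∀ a y s l → (a * y + 1) + (a * s + l) ≡ a * (y + s) + suc l
    regroup = solve-∀

  sum-superadditive : (T : ℕ → ℕ) → (∀ j k → T j + T k ≤ T (j + k)) →
    (xs : List A) (f : A → ℕ) → sum (map (T ∘ f) xs) ≤ T (sum (map f xs))
  sum-superadditive T sup []       f = z≤n
  sum-superadditive T sup (x ∷ xs) f =
    ≤-trans (+-monoʳ-≤ (T (f x)) (sum-superadditive T sup xs f)) (sup (f x) _)

  length-concatMap : {B : Set} (f : A → List B) (xs : List A) →
    length (concatMap f xs) ≡ sum (map (length ∘ f) xs)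
  length-concatMap f []       = refl
  length-concatMap f (x ∷ xs) = trans (length-++ (f x)) (cong (length (f x) +_) (length-concatMap f xs))

telescope : ∀ n (q : ℕ → ℕ) → (∀ i → i < n → q i ≤ q (suc i)) →
  sum (applyUpTo (λ i → q (suc i) ∸ q i) n) + q 0 ≡ q n
telescope zero    q mono = refl
telescope (suc n) q mono = begin
  (q 1 ∸ q 0) + rest + q 0   ≡⟨ cong (_+ q 0) (+-comm (q 1 ∸ q 0) rest) ⟩
  rest + (q 1 ∸ q 0) + q 0   ≡⟨ +-assoc rest (q 1 ∸ q 0) (q 0) ⟩
  rest + ((q 1 ∸ q 0) + q 0) ≡⟨ cong (rest +_) (m∸n+n≡m (mono 0 z<s)) ⟩
  rest + q 1                 ≡⟨ telescope n (q ∘ suc) (λ i i<n → mono (suc i) (s≤s i<n)) ⟩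
  q (suc n)                  ∎
  where
  open ≡-Reasoning
  rest : ℕ
  rest = sum (applyUpTo (λ i → q (suc (suc i)) ∸ q (suc i)) n)

slice-length : {X : Set} (w : List X) (a b : ℕ) → length (slice w a b) ≤ b ∸ a
slice-length w a b = ≤-trans (≤-reflexive (length-take (b ∸ a) (drop a w))) (m⊓n≤m _ _)

slice-length-≤ : {X : Set} (w : List X) (a b : ℕ) → length (slice w a b) ≤ length w
slice-length-≤ w a b = begin
  length (slice w a b)             ≡⟨ length-take (b ∸ a) (drop a w) ⟩
  (b ∸ a) ⊓ length (drop a w)      ≤⟨ m⊓n≤n _ _ ⟩
  length (drop a w)                ≡⟨ length-drop a w ⟩
  length w ∸ a                     ≤⟨ m∸n≤m _ a ⟩
  length w                         ∎
  where open ≤-Reasoning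

parts-total-length : {X : Set} (m : ℕ) (q : ℕ → ℕ) (w : List X) → (∀ i → i < m → q i ≤ q (suc i)) →
  sum (map (λ i → length (part q w i)) (upTo m)) ≤ q m
parts-total-length m q w mono = begin
  sum (map (λ i → length (part q w i)) (upTo m)) ≤⟨ sum-map-mono (upTo m) _ _ (λ i _ → slice-length w (q i) (q (suc i))) ⟩
  sum (map increment (upTo m))                   ≡⟨ cong sum (map-upTo increment m) ⟩
  sum (applyUpTo increment m)                    ≤⟨ m≤m+n _ (q 0) ⟩
  sum (applyUpTo increment m) + q 0              ≡⟨ telescope m q mono ⟩
  q m                                            ∎
  where
  open ≤-Reasoning
  increment : ℕ → ℕ
  increment i = q (suc i) ∸ q i

breakpoint-gap : ∀ m i k .{{_ : NonZero m}} →
  (suc i * k / m ∸ i * k / m) * m < k + m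
breakpoint-gap m i k = begin-strict
  (y ∸ x) * m           ≡⟨ *-distribʳ-∸ m y x ⟩
  y * m ∸ x * m         <⟨ ∸-monoˡ-< y*m< (*-monoˡ-≤ m x≤y) ⟩
  k + m + x * m ∸ x * m ≡⟨ m+n∸n≡m (k + m) (x * m) ⟩
  k + m                 ∎
  where
  open ≤-Reasoning
  x y : ℕ
  x = i * k / m
  y = suc i * k / m
  x≤y : x ≤ y
  x≤y = /-monoˡ-≤ m (*-monoˡ-≤ k (n≤1+n i))
  i*k< : i * k < m + x * m
  i*k< = begin-strict
    i * k             ≡⟨ m≡m%n+[m/n]*n (i * k) m ⟩
    i * k % m + x * m <⟨ +-monoˡ-< (x * m) (m%n<n (i * k) m) ⟩
    m + x * m         ∎
  y*m< : y * m < k + m + x * m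
  y*m< = begin-strict
    y * m           ≤⟨ m/n*n≤m (suc i * k) m ⟩
    k + i * k       <⟨ +-monoʳ-< k i*k< ⟩
    k + (m + x * m) ≡⟨ +-assoc k m (x * m) ⟨
    k + m + x * m   ∎

gap-halves : ∀ m c k → 2 ≤ m → c * m < k + m → 2 * c ≤ suc k
gap-halves m zero    k 2≤m _  = z≤n
gap-halves m (suc c) k 2≤m lt = begin
  2 * suc c         ≡⟨ *-suc 2 c ⟩
  suc (suc (2 * c)) ≤⟨ s≤s (begin-strict
    2 * c  ≡⟨ *-comm 2 c ⟩
    c * 2  ≤⟨ *-monoʳ-≤ c 2≤m ⟩
    c * m  <⟨ +-cancelʳ-< m (c * m) k (subst (_< k + m) (+-comm m (c * m)) lt) ⟩
    k      ∎) ⟩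
  suc k             ∎
  where open ≤-Reasoning

half-of-power : ∀ c k d → 2 * c ≤ suc k → k ≤ 2 ^ suc d → c ≤ 2 ^ d
half-of-power c k d 2c≤1+k k≤ = s≤s⁻¹ (*-cancelˡ-< 2 c (suc (2 ^ d)) (begin-strict
  2 * c              ≤⟨ 2c≤1+k ⟩
  suc k              ≤⟨ s≤s k≤ ⟩
  suc (2 * 2 ^ d)    <⟨ n<1+n _ ⟩
  2 + 2 * 2 ^ d      ≡⟨ *-suc 2 (2 ^ d) ⟨
  2 * suc (2 ^ d)    ∎))
  where open ≤-Reasoning

divℕ-lower : ∀ a b d → 1 ≤ d → b * d ≤ a → b ≤ divℕ a d
divℕ-lower a b (suc d) _ b*d≤a = begin
  b                   ≡⟨ m*n/n≡m b (suc d) ⟨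
  b * suc d / suc d   ≤⟨ /-monoˡ-≤ (suc d) b*d≤a ⟩
  a / suc d           ∎
  where open ≤-Reasoning

<2^suc-⌊log2⌋ : ∀ n (rec : Acc _<_ n) → n < 2 ^ suc (⌊log2⌋ n rec)
<2^suc-⌊log2⌋ zero          _        = s≤s z≤n
<2^suc-⌊log2⌋ (suc zero)    _        = s≤s (s≤s z≤n)
<2^suc-⌊log2⌋ (suc (suc k)) (acc rs) = begin-strict
  suc (suc k)                 ≤⟨ s≤s (s≤s (k≤2⌊k/2⌋+1 k)) ⟩
  suc (suc (2 * h + 1))       <⟨ n<1+n _ ⟩
  suc (suc (suc (2 * h + 1))) ≡⟨ double h ⟩
  2 * suc (suc h)             ≤⟨ *-monoʳ-≤ 2 (<2^suc-⌊log2⌋ (suc h) (rs (⌊n/2⌋<n (suc k)))) ⟩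
  2 * 2 ^ suc (⌊log2⌋ (suc h) (rs (⌊n/2⌋<n (suc k)))) ∎
  where
  open ≤-Reasoning
  h : ℕ
  h = ⌊ k /2⌋
  double : ∀ h → suc (suc (suc (2 * h + 1))) ≡ 2 * suc (suc h)
  double = solve-∀
  k≤2⌊k/2⌋+1 : ∀ k → k ≤ 2 * ⌊ k /2⌋ + 1
  k≤2⌊k/2⌋+1 zero          = z≤n
  k≤2⌊k/2⌋+1 (suc zero)    = s≤s z≤n
  k≤2⌊k/2⌋+1 (suc (suc k)) = ≤-trans (s≤s (s≤s (k≤2⌊k/2⌋+1 k))) (≤-reflexive (shift ⌊ k /2⌋))
    where
    shift : ∀ h → suc (suc (2 * h + 1)) ≡ 2 * suc h + 1
    shift = solve-∀

<2^suc⌊log₂⌋ : ∀ n → n < 2 ^ suc ⌊log₂ n ⌋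
<2^suc⌊log₂⌋ n = <2^suc-⌊log2⌋ n (<-wellFounded n)

⌊log₂⌋≤id : ∀ n → ⌊log₂ n ⌋ ≤ n
⌊log₂⌋≤id n = ≤-trans (⌊log₂⌋-mono-≤ (n≤2^n n)) (≤-reflexive (⌊log₂[2^n]⌋≡n n))
  where
  n≤2^n : ∀ n → n ≤ 2 ^ n
  n≤2^n zero    = z≤n
  n≤2^n (suc n) = +-mono-≤ (m^n>0 2 n) (≤-trans (n≤2^n n) (m≤m+n (2 ^ n) 0))

-- Bernoulli: (1 + 1/m)^k ≥ 1 + k/m, cleared of denominators.
bernoulli : ∀ m k → m ^ k * (m + k) ≤ m * suc m ^ k
bernoulli m zero    = ≤-reflexive (trans (+-identityʳ _) (trans (+-identityʳ m) (sym (*-identityʳ m))))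
bernoulli m (suc k) = begin
  m * x * (m + suc k)                 ≡⟨ split x m k ⟩
  x * m * (m + k) + x * m             ≤⟨ +-monoʳ-≤ (x * m * (m + k)) (*-monoʳ-≤ x (m≤m+n m k)) ⟩
  x * m * (m + k) + x * (m + k)       ≡⟨ factor x m k ⟩
  suc m * (x * (m + k))               ≤⟨ *-monoʳ-≤ (suc m) (bernoulli m k) ⟩
  suc m * (m * suc m ^ k)             ≡⟨ swap (suc m ^ k) m ⟩
  m * (suc m * suc m ^ k)             ∎
  where
  open ≤-Reasoning
  x : ℕ
  x = m ^ k
  split : ∀ x m k → m * x * (m + suc k) ≡ x * m * (m + k) + x * m
  split = solve-∀
  factor : ∀ x m k → x * m * (m + k) + x * (m + k) ≡ suc m * (x * (m + k))
  factor = solve-∀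
  swap : ∀ y m → suc m * (m * y) ≡ m * (suc m * y)
  swap = solve-∀

doubling : ∀ m .{{_ : NonZero m}} → ∀ a → 2 ^ a * m ^ (m * a) ≤ suc m ^ (m * a)
doubling m zero    rewrite *-zeroʳ m = ≤-refl
doubling m (suc a) rewrite *-suc m a | ^-distribˡ-+-* m m (m * a) | ^-distribˡ-+-* (suc m) m (m * a) =
  begin
  2 * 2 ^ a * (m ^ m * m ^ (m * a))  ≡⟨ regroup (2 ^ a) (m ^ m) (m ^ (m * a)) ⟩
  2 * m ^ m * (2 ^ a * m ^ (m * a))  ≤⟨ *-mono-≤ two≤ (doubling m a) ⟩
  suc m ^ m * suc m ^ (m * a)        ∎
  where
  open ≤-Reasoning
  regroup : ∀ p q r → 2 * p * (q * r) ≡ 2 * q * (p * r)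
  regroup = solve-∀
  two≤ : 2 * m ^ m ≤ suc m ^ m
  two≤ = *-cancelˡ-≤ m (begin
    m * (2 * m ^ m)  ≡⟨ double (m ^ m) m ⟩
    m ^ m * (m + m)  ≤⟨ bernoulli m m ⟩
    m * suc m ^ m    ∎)
    where
    double : ∀ y m → m * (2 * y) ≡ y * (m + m)
    double = solve-∀

rfloor-doubling : ∀ m .{{_ : NonZero m}} → ∀ a → 2 ^ a ≤ rfloor m (m * a)
rfloor-doubling m a = divℕ-lower _ _ _ (m^n>0 m (m * a)) (doubling m a)

firstExceed-≤ : ∀ m n j f jj → j ≤ jj → jj ≤ j + f → n < rfloor m jj → firstExceed m n j f ≤ jj
firstExceed-≤ m n j zero    jj j≤jj _ _ = j≤jj
firstExceed-≤ m n j (suc f) jj j≤jj jj≤ n< with n <? rfloor m j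
... | yes _ = j≤jj
... | no ¬n< with m≤n⇒m<n∨m≡n j≤jj
...   | inj₂ refl = ⊥-elim (¬n< n<)
...   | inj₁ j<jj = firstExceed-≤ m n (suc j) f jj j<jj (≤-trans jj≤ (≤-reflexive (+-suc j f))) n<

Jbound-≤ : ∀ m n .{{_ : NonZero m}} → Jbound m n ≤ m * suc ⌊log₂ n ⌋
Jbound-≤ m n = firstExceed-≤ m n 0 (m * suc n + 1) (m * suc ⌊log₂ n ⌋) z≤n
  (≤-trans (*-monoʳ-≤ m (s≤s (⌊log₂⌋≤id n))) (m≤m+n _ 1))
  (≤-trans (<2^suc⌊log₂⌋ n) (rfloor-doubling m (suc ⌊log₂ n ⌋)))

-- The candidate count 1 + (m+1)(2(J+1)+1) is at most 11 m² L whenever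
-- J ≤ m L (checked by exhibiting the non-negative slack polynomial in
-- m − 1 and L − 1).
candidate-count : ∀ m L J → 1 ≤ m → 1 ≤ L → J ≤ m * L → suc (suc m * suc (suc J * 2)) ≤ 11 * (m * m * L)
candidate-count (suc m) (suc L) J _ _ J≤ = begin
  suc (suc (suc m) * suc (suc J * 2))                  ≤⟨ s≤s (*-monoʳ-≤ (suc (suc m)) (s≤s (*-monoˡ-≤ 2 (s≤s J≤)))) ⟩
  suc (suc (suc m) * suc (suc (suc m * suc L) * 2))    ≤⟨ m≤m+n _ slack ⟩
  suc (suc (suc m) * suc (suc (suc m * suc L) * 2)) + slack ≡⟨ expand m L ⟩
  11 * (suc m * suc m * suc L)                         ∎
  where
  open ≤-Reasoning
  slack : ℕ
  slack = 9 * m * m * L + 9 * m * m + 16 * m * L + 13 * m + 7 * L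
  expand : ∀ m L → suc (suc (suc m) * suc (suc (suc m * suc L) * 2)) + (9 * m * m * L + 9 * m * m + 16 * m * L + 13 * m + 7 * L)
                   ≡ 11 * (suc m * suc m * suc L)
  expand = solve-∀

overhead-arith : ∀ m σ t J r s D n → 1 ≤ m → suc J ≤ σ → r ≤ σ → s ≤ σ →
  D ≤ m * (s * (s * suc t)) → n ≤ t →
  suc m + suc m * suc J + r * r + D + suc m * s + suc n ≤ 12 * (m * σ * σ * suc t)
overhead-arith m σ t J r s D n 1≤m J<σ r≤σ s≤σ D≤ n≤t = begin
  suc m + suc m * suc J + r * r + D + suc m * s + suc n
    ≤⟨ +-mono-≤ (+-mono-≤ (+-mono-≤ (+-mono-≤ (+-mono-≤ t₁ t₂) t₃) t₄) t₅) t₆ ⟩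
  2 * B + 2 * B + 2 * B + 2 * B + 2 * B + 2 * B ≡⟨ six B ⟩
  12 * B ∎
  where
  open ≤-Reasoning
  B : ℕ
  B = m * σ * σ * suc t
  1≤σ : 1 ≤ σ
  1≤σ = ≤-trans (s≤s z≤n) J<σ
  ≤*pos : ∀ x y → 1 ≤ y → x ≤ x * y
  ≤*pos x (suc y) _ = m≤m*n x (suc y)
  mσ≤B : m * σ ≤ B
  mσ≤B = ≤-trans (≤*pos (m * σ) σ 1≤σ) (≤*pos (m * σ * σ) (suc t) (s≤s z≤n))
  m≤B : m ≤ B
  m≤B = ≤-trans (≤*pos m σ 1≤σ) mσ≤B
  σσ≤B : σ * σ ≤ B
  σσ≤B = ≤-trans (m≤n*m (σ * σ) m ⦃ >-nonZero 1≤m ⦄)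
           (≤-trans (≤-reflexive (sym (*-assoc m σ σ))) (≤*pos (m * σ * σ) (suc t) (s≤s z≤n)))
  1+m≤2m : suc m ≤ 2 * m
  1+m≤2m = ≤-trans (+-monoˡ-≤ m 1≤m) (≤-reflexive (cong (m +_) (sym (+-identityʳ m))))
  ≤2B : ∀ {x y} → x ≤ y → y ≤ B → x ≤ 2 * B
  ≤2B x≤y y≤B = ≤-trans x≤y (≤-trans y≤B (m≤n*m B 2))
  2m*≤2B : ∀ {x} → x ≤ σ → suc m * x ≤ 2 * B
  2m*≤2B {x} x≤σ = begin
    suc m * x   ≤⟨ *-mono-≤ 1+m≤2m x≤σ ⟩
    2 * m * σ   ≡⟨ *-assoc 2 m σ ⟩
    2 * (m * σ) ≤⟨ *-monoʳ-≤ 2 mσ≤B ⟩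
    2 * B       ∎
  t₁ : suc m ≤ 2 * B
  t₁ = ≤-trans 1+m≤2m (*-monoʳ-≤ 2 m≤B)
  t₂ : suc m * suc J ≤ 2 * B
  t₂ = 2m*≤2B J<σ
  t₃ : r * r ≤ 2 * B
  t₃ = ≤2B (*-mono-≤ r≤σ r≤σ) σσ≤B
  t₄ : D ≤ 2 * B
  t₄ = ≤2B D≤ (begin
    m * (s * (s * suc t)) ≤⟨ *-monoʳ-≤ m (*-mono-≤ s≤σ (*-monoˡ-≤ (suc t) s≤σ)) ⟩
    m * (σ * (σ * suc t)) ≡⟨ regroup m σ (suc t) ⟩
    B                     ∎)
    where
    regroup : ∀ m σ u → m * (σ * (σ * u)) ≡ m * σ * σ * u
    regroup = solve-∀
  t₅ : suc m * s ≤ 2 * B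
  t₅ = 2m*≤2B s≤σ
  t₆ : suc n ≤ 2 * B
  t₆ = ≤2B (s≤s n≤t) (m≤n*m (suc t) (m * σ * σ) ⦃ >-nonZero (*-mono-≤ (*-mono-≤ 1≤m 1≤σ) 1≤σ) ⦄)
  six : ∀ B → 2 * B + 2 * B + 2 * B + 2 * B + 2 * B + 2 * B ≡ 12 * B
  six = solve-∀

all≤? : {P : ℕ → Set} → (∀ i → Dec (P i)) → ∀ n → Dec (∀ i → i ≤ n → P i)
all≤? P? n = map′ (λ h i i≤n → h (s≤s i≤n)) (λ h {i} i<1+n → h i (s≤s⁻¹ i<1+n)) (allUpTo? P? (suc n))

isPartition? : ∀ m len q → Dec (IsPartition m len q)
isPartition? m len q = map′ toPartition fromPartition
  (q 0 ≟ 0 ×-dec (q m ≟ len ×-dec allUpTo? (λ i → q i ≤? q (suc i)) m))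
  where
  Conditions : Set
  Conditions = q 0 ≡ 0 × q m ≡ len × (∀ {i} → i < m → q i ≤ q (suc i))
  toPartition : Conditions → IsPartition m len q
  toPartition (first , last , mono) = record { first = first ; last = last ; mono = λ i → mono }
  fromPartition : IsPartition m len q → Conditions
  fromPartition p = IsPartition.first p , IsPartition.last p , λ {i} → IsPartition.mono p i

_≈[_]_ : (ℕ → ℕ) → ℕ → (ℕ → ℕ) → Set
f ≈[ k ] g = ∀ i → i < k → f i ≡ g i

_◂_ : ℕ → (ℕ → ℕ) → ℕ → ℕ
(x ◂ g) zero    = x
(x ◂ g) (suc i) = g i

sequencesIn : List ℕ → ℕ → List (ℕ → ℕ)
sequencesIn L zero    = (λ _ → 0) ∷ []
sequencesIn L (suc k) = concatMap (λ x → map (x ◂_) (sequencesIn L k)) L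

sequencesIn-complete : ∀ L k q → (∀ i → i < k → q i ∈ L) →
  Σ (ℕ → ℕ) λ g → g ∈ sequencesIn L k × g ≈[ k ] q
sequencesIn-complete L zero    q _   = (λ _ → 0) , here refl , λ i ()
sequencesIn-complete L (suc k) q q∈L
  with sequencesIn-complete L k (q ∘ suc) (λ i i<k → q∈L (suc i) (s≤s i<k))
... | g , g∈ , g≈ = q 0 ◂ g , ∈-concatMap⁺ (λ x → map (x ◂_) (sequencesIn L k)) (Any.map extend (q∈L 0 z<s)) , agree
  where
  extend : ∀ {x} → q 0 ≡ x → (q 0 ◂ g) ∈ map (x ◂_) (sequencesIn L k)
  extend refl = ∈-map⁺ (q 0 ◂_) g∈
  agree : (q 0 ◂ g) ≈[ suc k ] q
  agree zero    _     = refl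
  agree (suc i) i<1+k = g≈ i (s≤s⁻¹ i<1+k)

module OneCall {X : Set} (bb : BlackBox X) (a : ℕ) where

  m : ℕ
  m = suc (suc a)

  open AlgorithmB bb m

  -- Each part of the equipartition has at most ⌈|u|/2⌉ characters; in
  -- particular it halves the exponent of a power-of-two bound on |u|.
  part-halves : ∀ (u : List X) i d → length u ≤ 2 ^ suc d → length (P u i) ≤ 2 ^ d
  part-halves u i d u≤ = ≤-trans (slice-length u (eqp u i) (eqp u (suc i)))
    (half-of-power gap (length u) d
      (gap-halves m gap (length u) (s≤s (s≤s z≤n)) (breakpoint-gap m i (length u))) u≤)
    where
    gap : ℕ
    gap = eqp u (suc i) ∸ eqp u i

  subproblems-total : ∀ (u v : List X) q → IsPartition m (length v) q →
    sum (map (λ i → length (P u i) + length (part q v i)) (upTo m)) ≤ length u + length v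
  subproblems-total u v q q-part = begin
    sum (map (λ i → length (P u i) + length (part q v i)) (upTo m))
      ≡⟨ sum-map-+ (upTo m) (λ i → length (P u i)) (λ i → length (part q v i)) ⟩
    sum (map (λ i → length (P u i)) (upTo m)) + sum (map (λ i → length (part q v i)) (upTo m))
      ≤⟨ +-mono-≤ (parts-total-length m (eqp u) u eqp-mono) (parts-total-length m q v (IsPartition.mono q-part)) ⟩
    eqp u m + q m
      ≡⟨ cong₂ _+_ eqp-last (IsPartition.last q-part) ⟩
    length u + length v ∎
    where
    open ≤-Reasoning
    eqp-mono : ∀ i → i < m → eqp u i ≤ eqp u (suc i)
    eqp-mono i _ = /-monoˡ-≤ m (*-monoˡ-≤ (length u) (n≤1+n i))
    eqp-last : eqp u m ≡ length u
    eqp-last = trans (cong (_/ m) (*-comm m (length u))) (m*n/n≡m (length u) m)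

  candidateOffsets : List X → ℕ → ℕ → List ℕ
  candidateOffsets u i j = (eqp u i + rceil m j) ∷
    (if does (rfloor m j ≤? eqp u i) then (eqp u i ∸ rfloor m j) ∷ [] else [])

  candidateRow : List X → List X → ℕ → List ℕ
  candidateRow u v i = eqp u i ∷ concatMap (candidateOffsets u i) (upTo (suc (J u v)))

  rawS-length : ∀ (u v : List X) → length (rawS u v) ≤ suc (suc m * suc (suc (J u v) * 2))
  rawS-length u v = begin
    length (rawS u v)                                  ≤⟨ length-filter (_≤? length v) (length v ∷ concatMap row (upTo (suc m))) ⟩
    suc (length (concatMap row (upTo (suc m))))        ≡⟨ cong suc (length-concatMap row (upTo (suc m))) ⟩
    suc (sum (map (length ∘ row) (upTo (suc m))))      ≤⟨ s≤s (sum-map-≤-const (upTo (suc m)) (length ∘ row) _ row-length) ⟩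
    suc (length (upTo (suc m)) * suc (suc (J u v) * 2)) ≡⟨ cong (λ k → suc (k * suc (suc (J u v) * 2))) (length-upTo (suc m)) ⟩
    suc (suc m * suc (suc (J u v) * 2))                ∎
    where
    open ≤-Reasoning
    offsets : ℕ → ℕ → List ℕ
    offsets = candidateOffsets u
    row : ℕ → List ℕ
    row = candidateRow u v
    offsets-length : ∀ i j → length (offsets i j) ≤ 2
    offsets-length i j with does (rfloor m j ≤? eqp u i)
    ... | true  = ≤-refl
    ... | false = s≤s z≤n
    row-length : ∀ i → i ∈ upTo (suc m) → length (row i) ≤ suc (suc (J u v) * 2)
    row-length i _ = s≤s (begin
      length (concatMap (offsets i) (upTo (suc (J u v))))     ≡⟨ length-concatMap (offsets i) (upTo (suc (J u v))) ⟩
      sum (map (length ∘ offsets i) (upTo (suc (J u v))))     ≤⟨ sum-map-≤-const (upTo (suc (J u v))) (length ∘ offsets i) 2 (λ j _ → offsets-length i j) ⟩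
      length (upTo (suc (J u v))) * 2                         ≡⟨ cong (_* 2) (length-upTo (suc (J u v))) ⟩
      suc (J u v) * 2                                         ∎)

  candidates-≤ : ∀ (u v : List X) L → suc ⌊log₂ (length u + length v) ⌋ ≤ L →
    suc (J u v) ≤ 11 * (m * m * L) × length (rawS u v) ≤ 11 * (m * m * L)
  candidates-≤ u v L log≤L = ≤-trans (s≤s J≤count) count , ≤-trans (rawS-length u v) count
    where
    J≤count : J u v ≤ suc m * suc (suc (J u v) * 2)
    J≤count = ≤-trans (≤-trans (n≤1+n _) (≤-trans (m≤m*n (suc (J u v)) 2) (n≤1+n _)))
                      (m≤n*m (suc (suc (J u v) * 2)) (suc m))
    J≤ : J u v ≤ m * L
    J≤ = ≤-trans (Jbound-≤ m (length u + length v)) (*-monoʳ-≤ m log≤L)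
    count : suc (suc m * suc (suc (J u v) * 2)) ≤ 11 * (m * m * L)
    count = candidate-count m L (J u v) (s≤s z≤n) (≤-trans (s≤s z≤n) log≤L) J≤

  dpCost-≤ : ∀ (u v : List X) t → (∀ j l′ l → time bb (P u j) (slice v l′ l) ≤ t) →
    dpCost u v ≤ m * (length (S u v) * (length (S u v) * suc t))
  dpCost-≤ u v t time≤ = begin
    dpCost u v                          ≤⟨ sum-map-≤-const (upTo m) row (s * (s * suc t)) (λ j _ → row-≤ j) ⟩
    length (upTo m) * (s * (s * suc t)) ≡⟨ cong (_* (s * (s * suc t))) (length-upTo m) ⟩
    m * (s * (s * suc t))               ∎
    where
    open ≤-Reasoning
    s : ℕ
    s = length (S u v)
    calls : ℕ → ℕ → ℕ
    calls j l = sum (map (λ l′ → suc (time bb (P u j) (slice v l′ l))) (filter (_≤? l) (S u v)))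
    row : ℕ → ℕ
    row j = sum (map (calls j) (S u v))
    calls-≤ : ∀ j l → calls j l ≤ s * suc t
    calls-≤ j l = ≤-trans
      (sum-map-≤-const (filter (_≤? l) (S u v)) _ (suc t) (λ l′ _ → s≤s (time≤ j l′ l)))
      (*-monoˡ-≤ (suc t) (length-filter (_≤? l) (S u v)))
    row-≤ : ∀ j → row j ≤ s * (s * suc t)
    row-≤ j = sum-map-≤-const (S u v) (calls j) (s * suc t) (λ l _ → calls-≤ j l)

  Feasible : List X → List X → (ℕ → ℕ) → Set
  Feasible u v q = IsPartition m (length v) q × (∀ i → i ≤ m → q i ∈ S u v)

  feasible? : ∀ u v q → Dec (Feasible u v q)
  feasible? u v q = isPartition? m (length v) q ×-dec all≤? (λ i → q i ∈? S u v) m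

  feasible-resp : ∀ u v g q → g ≈[ suc m ] q → Feasible u v q → Feasible u v g
  feasible-resp u v g q g≈q (q-part , q∈S) = g-part , λ i i≤m → subst (_∈ S u v) (sym (g≈q i (s≤s i≤m))) (q∈S i i≤m)
    where
    g-part : IsPartition m (length v) g
    g-part = record
      { first = trans (g≈q 0 z<s) (IsPartition.first q-part)
      ; last  = trans (g≈q m ≤-refl) (IsPartition.last q-part)
      ; mono  = λ i i<m → subst₂ _≤_ (sym (g≈q i (m<n⇒m<1+n i<m))) (sym (g≈q (suc i) (s≤s i<m)))
                                    (IsPartition.mono q-part i i<m)
      }

  objective-resp : ∀ u v g q → g ≈[ suc m ] q → objective u v g ≤ objective u v q
  objective-resp u v g q g≈q = sum-map-mono (upTo m) _ _ λ i i∈ →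
    ≤-reflexive (cong₂ (λ a b → 𝒜 bb (P u i) (slice v a b))
      (g≈q i (m<n⇒m<1+n (∈-upTo⁻ i∈))) (g≈q (suc i) (s≤s (∈-upTo⁻ i∈))))

  -- 0 and |v| are always candidates: 0 = p₀, and |v| is listed explicitly.
  0∈S : ∀ u v → 0 ∈ S u v
  0∈S u v = ∈-deduplicate⁺ ℕ._≟_ (∈-filter⁺ (_≤? length v) {xs = length v ∷ concatMap (candidateRow u v) (upTo (suc m))}
    (there (∈-concatMap⁺ (candidateRow u v) {xs = upTo (suc m)} (here (here refl)))) z≤n)

  |v|∈S : ∀ u v → length v ∈ S u v
  |v|∈S u v = ∈-deduplicate⁺ ℕ._≟_ (∈-filter⁺ (_≤? length v) (here refl) ≤-refl)

  allInFirst : List X → ℕ → ℕ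
  allInFirst v zero    = 0
  allInFirst v (suc i) = length v

  allInFirst-feasible : ∀ u v → Feasible u v (allInFirst v)
  allInFirst-feasible u v = record { first = refl ; last = refl ; mono = mono } , inS
    where
    mono : ∀ i → i < m → allInFirst v i ≤ allInFirst v (suc i)
    mono zero    _ = z≤n
    mono (suc i) _ = ≤-refl
    inS : ∀ i → i ≤ m → allInFirst v i ∈ S u v
    inS zero    _ = 0∈S u v
    inS (suc i) _ = |v|∈S u v

  candidates : List X → List X → List (ℕ → ℕ)
  candidates u v = filter (feasible? u v) (sequencesIn (S u v) (suc m))

  optimal : List X → List X → ℕ → ℕ
  optimal u v = argmin (objective u v) (allInFirst v) (candidates u v)

  -- The minimiser is feasible (so is the default allInFirst) …
  optimal-feasible : ∀ u v → Feasible u v (optimal u v)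
  optimal-feasible u v = argmin-all (objective u v) (allInFirst-feasible u v)
    (all-filter (feasible? u v) (sequencesIn (S u v) (suc m)))

  -- … and no feasible q′ has a smaller objective: q′ agrees on q₀, …, q_m
  -- with a listed candidate.
  optimal-minimal : ∀ u v q′ → IsPartition m (length v) q′ → (∀ i → i ≤ m → q′ i ∈ S u v) →
    objective u v (optimal u v) ≤ objective u v q′
  optimal-minimal u v q′ q′-part q′∈S
    with sequencesIn-complete (S u v) (suc m) q′ (λ i i<1+m → q′∈S i (s≤s⁻¹ i<1+m))
  ... | g , g∈ , g≈q′ = ≤-trans
    (All.lookup (f[argmin]≤f[xs] (allInFirst v) (candidates u v))
      (∈-filter⁺ (feasible? u v) g∈ (feasible-resp u v g q′ g≈q′ (q′-part , q′∈S))))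
    (objective-resp u v g q′ g≈q′)

  -- Algorithm B has a run on every input: recurse on |u| ≤ 2^d, which the
  -- equipartition halves.
  run-exists : ∀ d (u v : List X) → length u ≤ 2 ^ d → Σ ℕ (Run u v)
  run-exists d u v u≤ with length u ≤? 1
  ... | yes short = _ , base short
  run-exists zero    u v u≤ | no long = ⊥-elim (long u≤)
  run-exists (suc d) u v u≤ | no long =
    _ , step (≰⇒> long) q (proj₁ (optimal-feasible u v)) (proj₂ (optimal-feasible u v))
             (optimal-minimal u v) (λ i → proj₁ (child i)) (λ i _ → proj₂ (child i))
    where
    q : ℕ → ℕ
    q = optimal u v
    child : ∀ i → Σ ℕ (Run (P u i) (part q v i))
    child i = run-exists d (P u i) (part q v i) (part-halves u i d u≤)

superadditive-≥id : (T : ℕ → ℕ) → (∀ j k → T j + T k ≤ T (j + k)) → 1 ≤ T 1 → ∀ n → n ≤ T n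
superadditive-≥id T sup T1≥1 zero    = z≤n
superadditive-≥id T sup T1≥1 (suc n) = ≤-trans (+-mono-≤ T1≥1 (superadditive-≥id T sup T1≥1 n)) (sup 1 n)

level-arith : ∀ Z t d m → 1 ≤ t → m ≤ Z * t →
  12 * (Z * suc t) + (suc d * (25 * Z) * t + m) ≤ suc (suc d) * (25 * Z) * t + 1
level-arith Z t d m 1≤t m≤Zt = begin
  12 * (Z * suc t) + (suc d * (25 * Z) * t + m)
    ≤⟨ +-mono-≤ (*-monoʳ-≤ 12 (*-monoʳ-≤ Z (+-monoˡ-≤ t 1≤t))) (+-monoʳ-≤ (suc d * (25 * Z) * t) m≤Zt) ⟩
  12 * (Z * (t + t)) + (suc d * (25 * Z) * t + Z * t) ≡⟨ collect Z t d ⟩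
  suc (suc d) * (25 * Z) * t                          ≤⟨ m≤m+n _ 1 ⟩
  suc (suc d) * (25 * Z) * t + 1                      ∎
  where
  open ≤-Reasoning
  collect : ∀ Z t d → 12 * (Z * (t + t)) + (suc d * (25 * Z) * t + Z * t) ≡ suc (suc d) * (25 * Z) * t
  collect = solve-∀

module RunningTime {X : Set} (bb : BlackBox X) (a : ℕ) (T : ℕ → ℕ)
  (T-mono : ∀ {i j} → i ≤ j → T i ≤ T j)
  (T-superadditive : ∀ j k → T j + T k ≤ T (j + k))
  (time-≤ : ∀ n (u v : List X) → length u + length v ≤ n → time bb u v ≤ T n)
  (time-pos : ∀ (u v : List X) → 1 ≤ length u + length v → 1 ≤ time bb u v)
  (L : ℕ) where

  open OneCall bb a
  open AlgorithmB bb m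

  -- If the alphabet has a character x, then T 1 ≥ time(x, ε) ≥ 1.
  T1≥1 : X → 1 ≤ T 1
  T1≥1 x = ≤-trans (time-pos (x ∷ []) [] (s≤s z≤n)) (time-≤ 1 (x ∷ []) [] ≤-refl)

  size-≤-T : ∀ (u v : List X) → length u + length v ≤ T (length u + length v)
  size-≤-T []      []      = z≤n
  size-≤-T (x ∷ _) _       = superadditive-≥id T T-superadditive (T1≥1 x) _
  size-≤-T []      (y ∷ _) = superadditive-≥id T T-superadditive (T1≥1 y) _

  -- σ bounds the candidate lists, Z = m σ² the overhead of a call, K = 25 Z
  -- the cost of one level of the recursion (all per unit of T).
  σ Z K : ℕ
  σ = 11 * (m * m * L)
  Z = m * σ * σ
  K = 25 * Z

  -- For L ≥ 1 we have σ ≥ 1, so m ≤ Z.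
  m≤Z : 1 ≤ L → m ≤ Z
  m≤Z 1≤L = ≤-trans (m≤m*n m σ ⦃ σ≠0 ⦄) (m≤m*n (m * σ) σ ⦃ σ≠0 ⦄)
    where
    σ≠0 : NonZero σ
    σ≠0 = >-nonZero (m≤n⇒m≤o*n 11 (m≤n⇒m≤o*n (m * m) 1≤L))

  overhead-≤ : ∀ (u v : List X) → suc ⌊log₂ (length u + length v) ⌋ ≤ L →
    overhead u v ≤ 12 * (Z * suc (T (length u + length v)))
  overhead-≤ u v log≤L = overhead-arith m σ (T n) (J u v) (length (rawS u v)) (length (S u v))
    (dpCost u v) n (s≤s z≤n) J<σ rawS≤σ (≤-trans (length-deduplicate ℕ._≟_ (rawS u v)) rawS≤σ)
    (dpCost-≤ u v (T n) λ j l′ l → time-≤ n (P u j) (slice v l′ l)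
      (+-mono-≤ (slice-length-≤ u (eqp u j) (eqp u (suc j))) (slice-length-≤ v l′ l)))
    (size-≤-T u v)
    where
    n : ℕ
    n = length u + length v
    J<σ : suc (J u v) ≤ σ
    J<σ = proj₁ (candidates-≤ u v L log≤L)
    rawS≤σ : length (rawS u v) ≤ σ
    rawS≤σ = proj₂ (candidates-≤ u v L log≤L)

  -- A run on (u, v) with |u| ≤ 2^d takes time ≤ (d+1) K T(n) + 1: the
  -- recursion has depth ≤ d and the sizes of the calls on each level add
  -- up to at most n, so by superadditivity each level costs ≤ K T(n).
  time-bound : ∀ d (u v : List X) t → Run u v t → length u ≤ 2 ^ d →
    suc ⌊log₂ (length u + length v) ⌋ ≤ L → t ≤ suc d * K * T (length u + length v) + 1
  time-bound d u v _ (base _) _ log≤L = begin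
    suc (length v)                                   ≤⟨ s≤s (≤-trans (m≤n+m (length v) (length u)) (size-≤-T u v)) ⟩
    suc (T n)                                        ≤⟨ s≤s (m≤n*m (T n) (suc d * K) ⦃ >-nonZero (m≤n⇒m≤o*n (suc d) 1≤K) ⦄) ⟩
    suc (suc d * K * T n)                            ≡⟨ +-comm 1 _ ⟩
    suc d * K * T n + 1                              ∎
    where
    open ≤-Reasoning
    n : ℕ
    n = length u + length v
    1≤K : 1 ≤ K
    1≤K = ≤-trans (≤-trans (s≤s z≤n) (m≤Z (≤-trans (s≤s z≤n) log≤L))) (m≤n*m Z 25)
  time-bound zero    u v _ (step 2≤|u| _ _ _ _ _ _) u≤1 _ = ⊥-elim (<⇒≱ 2≤|u| u≤1)
  time-bound (suc d) u v _ (step 2≤|u| q q-part _ _ ts runs) u≤ log≤L = begin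
    overhead u v + sum (map ts (upTo m))        ≤⟨ +-mono-≤ (overhead-≤ u v log≤L) children ⟩
    12 * (Z * suc (T n)) + (suc d * K * T n + m) ≤⟨ level-arith Z (T n) d m 1≤Tn m≤ZTn ⟩
    suc (suc d) * K * T n + 1                    ∎
    where
    open ≤-Reasoning
    n : ℕ
    n = length u + length v
    size : ℕ → ℕ
    size i = length (P u i) + length (part q v i)
    size-≤ : ∀ i → size i ≤ n
    size-≤ i = +-mono-≤ (slice-length-≤ u (eqp u i) (eqp u (suc i))) (slice-length-≤ v (q i) (q (suc i)))
    child : ∀ i → i < m → ts i ≤ suc d * K * T (size i) + 1
    child i i<m = time-bound d (P u i) (part q v i) (ts i) (runs i i<m) (part-halves u i d u≤)
      (≤-trans (s≤s (⌊log₂⌋-mono-≤ (size-≤ i))) log≤L)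
    children : sum (map ts (upTo m)) ≤ suc d * K * T n + m
    children = begin
      sum (map ts (upTo m))                                   ≤⟨ sum-map-mono (upTo m) ts _ (λ i i∈ → child i (∈-upTo⁻ i∈)) ⟩
      sum (map (λ i → suc d * K * T (size i) + 1) (upTo m))   ≡⟨ sum-map-affine (upTo m) (T ∘ size) (suc d * K) ⟩
      suc d * K * sum (map (T ∘ size) (upTo m)) + length (upTo m)
        ≤⟨ +-mono-≤ (*-monoʳ-≤ (suc d * K) (sum-superadditive T T-superadditive (upTo m) size)) (≤-reflexive (length-upTo m)) ⟩
      suc d * K * T (sum (map size (upTo m))) + m             ≤⟨ +-monoˡ-≤ m (*-monoʳ-≤ (suc d * K) (T-mono (subproblems-total u v q q-part))) ⟩
      suc d * K * T n + m                                     ∎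
    1≤Tn : 1 ≤ T n
    1≤Tn = ≤-trans (≤-trans (s≤s z≤n) 2≤|u|) (≤-trans (m≤m+n (length u) (length v)) (size-≤-T u v))
    m≤ZTn : m ≤ Z * T n
    m≤ZTn = ≤-trans (m≤Z (≤-trans (s≤s z≤n) log≤L)) (m≤m*n Z (T n) ⦃ >-nonZero 1≤Tn ⦄)

final-arith : ∀ m L t → 1 ≤ m → 1 ≤ L →
  suc L * (25 * (m * (11 * (m * m * L)) * (11 * (m * m * L)))) * t + 1 ≤ 6051 * suc t * m ^ 5 * L ^ 3
final-arith m L t 1≤m 1≤L = begin
  suc L * (25 * (m * (11 * (m * m * L)) * (11 * (m * m * L)))) * t + 1
    ≤⟨ +-monoˡ-≤ 1 (*-monoˡ-≤ t (*-monoˡ-≤ (25 * (m * (11 * (m * m * L)) * (11 * (m * m * L)))) (+-monoˡ-≤ L 1≤L))) ⟩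
  (L + L) * (25 * (m * (11 * (m * m * L)) * (11 * (m * m * L)))) * t + 1
    ≡⟨ cong (_+ 1) (normalise m L t) ⟩
  6050 * t * (m ^ 5 * L ^ 3) + 1
    ≤⟨ +-mono-≤ (*-monoˡ-≤ (m ^ 5 * L ^ 3) (*-monoˡ-≤ t (n≤1+n 6050))) (m≤n⇒m≤o*n 6051 (*-mono-≤ (m^n>0 m ⦃ >-nonZero 1≤m ⦄ 5) (m^n>0 L ⦃ >-nonZero 1≤L ⦄ 3))) ⟩
  6051 * t * (m ^ 5 * L ^ 3) + 6051 * (m ^ 5 * L ^ 3)
    ≡⟨ collect m L t ⟩
  6051 * suc t * m ^ 5 * L ^ 3 ∎
  where
  open ≤-Reasoning
  -- (the ring solver does not handle _^_, so the powers are written out)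
  normalise : ∀ m L t → (L + L) * (25 * (m * (11 * (m * m * L)) * (11 * (m * m * L)))) * t
                      ≡ 6050 * t * ((m * (m * (m * (m * (m * 1))))) * (L * (L * (L * 1))))
  normalise = solve-∀
  collect : ∀ m L t → 6051 * t * ((m * (m * (m * (m * (m * 1))))) * (L * (L * (L * 1))))
                      + 6051 * ((m * (m * (m * (m * (m * 1))))) * (L * (L * (L * 1))))
                    ≡ 6051 * suc t * (m * (m * (m * (m * (m * 1))))) * (L * (L * (L * 1)))
  collect = solve-∀

-- Runs exist (OneCall.run-exists) and, with L = ⌊log₂ n⌋ + 1 so that
-- |u| ≤ n < 2^L, every run takes time ≤ (L+1) K T(n) + 1 = O(T(n) m⁵ L³).
proposition9 : {X : Set} (_≟_ : DecidableEquality X) (bb : BlackBox X) (γ T : ℕ → ℕ) →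
    (∀ {a b} → a ≤ b → γ a ≤ γ b) →
    (∀ n (u v : List X) → length u + length v ≤ n →
       ed _≟_ u v ≤ 𝒜 bb u v × 𝒜 bb u v ≤ γ n * ed _≟_ u v) →
    (∀ {a b} → a ≤ b → T a ≤ T b) →
    (∀ j k → T j + T k ≤ T (j + k)) →
    (∀ n (u v : List X) → length u + length v ≤ n → time bb u v ≤ T n) →
    (∀ (u v : List X) → 1 ≤ length u + length v → 1 ≤ time bb u v) →
    Σ ℕ λ c → Σ ℕ λ k → ∀ (m : ℕ) → 2 ≤ m → ∀ (u v : List X) →
      (Σ ℕ λ t → AlgorithmB.Run bb m u v t) ×
      (∀ t → AlgorithmB.Run bb m u v t →
         t ≤ c * suc (T (length u + length v)) * m ^ 5 * suc ⌊log₂ (length u + length v) ⌋ ^ k)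
proposition9 _ bb _ T _ _ T-mono T-superadditive time-≤ time-pos = 6051 , 3 , analysis
  where
  analysis : ∀ (m : ℕ) → 2 ≤ m → ∀ (u v : List _) →
    (Σ ℕ λ t → AlgorithmB.Run bb m u v t) ×
    (∀ t → AlgorithmB.Run bb m u v t →
       t ≤ 6051 * suc (T (length u + length v)) * m ^ 5 * suc ⌊log₂ (length u + length v) ⌋ ^ 3)
  analysis (suc (suc a)) (s≤s (s≤s z≤n)) u v = OneCall.run-exists bb a L u v |u|≤2^L , bound
    where
    n L : ℕ
    n = length u + length v
    L = suc ⌊log₂ n ⌋
    open RunningTime bb a T T-mono T-superadditive time-≤ time-pos L using (time-bound)
    |u|≤2^L : length u ≤ 2 ^ L
    |u|≤2^L = <⇒≤ (≤-<-trans (m≤m+n (length u) (length v)) (<2^suc⌊log₂⌋ n))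
    bound : ∀ t → AlgorithmB.Run bb (suc (suc a)) u v t → t ≤ 6051 * suc (T n) * suc (suc a) ^ 5 * L ^ 3
    bound t run = ≤-trans (time-bound L u v t run |u|≤2^L ≤-refl)
                          (final-arith (suc (suc a)) L (T n) (s≤s z≤n) (s≤s z≤n))
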